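{- Let $P$ be a $*$-term and $Q$ a $P^d$-term. Then $\mathrm{se}(P \wedge^{\circ} Q)$ has the unique conjunction decomposition $(\mathrm{se}(P)[\mathsf{T}\mapsto\Box], \mathrm{se}(Q))$ and no disjunction decomposition. Let $P$ be a $*$-term and $Q$ a $P^c$-term. Then $\mathrm{se}(P \vee^{\circ} Q)$ has no conjunction decomposition and its unique disjunction decomposition is $(\mathrm{se}(P)[\mathsf{F}\mapsto\Box], \mathrm{se}(Q))$.
   Context: Let $A$ be a countable set of atoms. SCL-terms: $P ::= a \ (a\in A) \mid \mathsf{T} \mid \mathsf{F} \mid \neg P \mid (P \wedge^{\circ} P) \mid (P \vee^{\circ} P)$ (short-circuit left-sequential connectives). Subgrammars (with $a\in A$): $\mathsf{T}$-terms $P^{\mathsf{T}} ::= \mathsf{T} \mid (a \wedge^{\circ} P^{\mathsf{T}}) \vee^{\circ} P^{\mathsf{T}}$; $\mathsf{F}$-terms $P^{\mathsf{F}} ::= \mathsf{F} \mid (a \vee^{\circ} P^{\mathsf{F}}) \wedge^{\circ} P^{\mathsf{F}}$; $\ell$-terms $P^{\ell} ::= (a \wedge^{\circ} P^{\mathsf{T}}) \vee^{\circ} P^{\mathsf{F}} \mid (\neg a \wedge^{\circ} P^{\mathsf{T}}) \vee^{\circ} P^{\mathsf{F}}$; $*$-terms $P^* ::= P^c \mid P^d$, with $P^c ::= P^{\ell} \mid P^* \wedge^{\circ} P^d$ and $P^d ::= P^{\ell} \mid P^* \vee^{\circ} P^c$. $\mathcal{T}$ is the set of finite binary trees with leaves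 in $\{\mathsf{T},\mathsf{F}\}$: $\mathsf{T},\mathsf{F}\in\mathcal{T}$, $(X \trianglelefteq a \trianglerighteq Y)\in\mathcal{T}$ for $X,Y\in\mathcal{T}$, $a\in A$; $\mathcal{T}_{\Box}$ is the analogous set with leaves in $\{\mathsf{T},\mathsf{F},\Box\}$. Leaf replacement $X[\ell_1\mapsto Y_1,\ell_2\mapsto Y_2]$ replaces every leaf $\ell_i$ by $Y_i$, other leaves unchanged. Depth: $d(\text{leaf})=0$, $d(Y \trianglelefteq a \trianglerighteq Z) = 1+\max(d(Y),d(Z))$. $\mathrm{se}$: $\mathrm{se}(\mathsf{T}) = \mathsf{T}$, $\mathrm{se}(\mathsf{F}) = \mathsf{F}$, $\mathrm{se}(a) = \mathsf{T} \trianglelefteq a \trianglerighteq \mathsf{F}$, $\mathrm{se}(\neg P) = \mathrm{se}(P)[\mathsf{T}\mapsto\mathsf{F}, \mathsf{F}\mapsto\mathsf{T}]$, $\mathrm{se}(P \wedge^{\circ} Q) = \mathrm{se}(P)[\mathsf{T}\mapsto \mathrm{se}(Q)]$, $\mathrm{se}(P \vee^{\circ} Q) = \mathrm{se}(P)[\mathsf{F}\mapsto \mathrm{se}(Q)]$. For $X\in\mathcal{T}$, $(Y,Z)\in\mathcal{T}_{\Box}\times\mathcal{T}$ is a candidate conjunction decomposition (ccd) of $X$ if $X = Y[\Box\mapsto Z]$, $Y$ contains $\Box$, $Y$ contains $\mathsf{F}$ but not $\mathsf{T}$, and $Z$ contains both $\mathsf{T}$ and $\mathsf{F}$; it is a candidate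 disjunction decomposition (cdd) if the same holds except that $Y$ contains $\mathsf{T}$ but not $\mathsf{F}$. A conjunction decomposition (cd) of $X$ is a ccd $(Y,Z)$ such that no other ccd $(Y',Z')$ of $X$ has $d(Z')<d(Z)$; a disjunction decomposition (dd) is defined likewise from cdds. -}

module Defs where

open import Data.Nat using (ℕ; suc; _⊔_; _<_)
open import Data.Product using (_×_; _,_)
open import Relation.Binary.PropositionalEquality using (_≡_)
open import Relation.Nullary using (¬_)

-- Atoms: the countable set A is taken to be ℕ.
Atom : Set
Atom = ℕ

data SCL : Set where
  at   : Atom → SCL
  `T   : SCL
  `F   : SCL
  ¬ˢ_  : SCL → SCL
  _∧∘_ : SCL → SCL → SCL
  _∨∘_ : SCL → SCL → SCL

data IsT : SCL → Set where
  tT  : IsT `T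
  tCons : ∀ {a P Q} → IsT P → IsT Q → IsT ((at a ∧∘ P) ∨∘ Q)

data IsF : SCL → Set where
  fF  : IsF `F
  fCons : ∀ {a P Q} → IsF P → IsF Q → IsF ((at a ∨∘ P) ∧∘ Q)

data IsLit : SCL → Set where
  lPos : ∀ {a P Q} → IsT P → IsF Q → IsLit ((at a ∧∘ P) ∨∘ Q)
  lNeg : ∀ {a P Q} → IsT P → IsF Q → IsLit (((¬ˢ at a) ∧∘ P) ∨∘ Q)

mutual
  data IsStar : SCL → Set where
    sC : ∀ {P} → IsC P → IsStar P
    sD : ∀ {P} → IsD P → IsStar P

  data IsC : SCL → Set where
    cLit : ∀ {P} → IsLit P → IsC P
    cAnd : ∀ {P Q} → IsStar P → IsD Q → IsC (P ∧∘ Q)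

  data IsD : SCL → Set where
    dLit : ∀ {P} → IsLit P → IsD P
    dOr  : ∀ {P Q} → IsStar P → IsC Q → IsD (P ∨∘ Q)

data TF : Set where
  𝐓 𝐅 : TF

data TFB : Set where
  𝐓 𝐅 □ : TFB

-- Finite binary trees with leaves in L (𝒯 = Tree TF, 𝒯□ = Tree TFB)
data Tree (L : Set) : Set where
  leaf : L → Tree L
  node : Tree L → Atom → Tree L → Tree L   -- node Y a Z  =  Y ⊴ a ⊵ Z

replace : ∀ {L M : Set} → (L → Tree M) → Tree L → Tree M
replace f (leaf l)     = f l
replace f (node y a z) = node (replace f y) a (replace f z)

depth : ∀ {L : Set} → Tree L → ℕ
depth (leaf _)     = 0
depth (node y _ z) = suc (depth y ⊔ depth z)

data Contains {L : Set} (l : L) : Tree L → Set where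
  here  : Contains l (leaf l)
  left  : ∀ {y a z} → Contains l y → Contains l (node y a z)
  right : ∀ {y a z} → Contains l z → Contains l (node y a z)

swapTF : Tree TF → Tree TF
swapTF = replace λ { 𝐓 → leaf 𝐅 ; 𝐅 → leaf 𝐓 }

se : SCL → Tree TF
se (at a)   = node (leaf 𝐓) a (leaf 𝐅)
se `T       = leaf 𝐓
se `F       = leaf 𝐅
se (¬ˢ P)   = swapTF (se P)
se (P ∧∘ Q) = replace (λ { 𝐓 → se Q ; 𝐅 → leaf 𝐅 }) (se P)
se (P ∨∘ Q) = replace (λ { 𝐓 → leaf 𝐓 ; 𝐅 → se Q }) (se P)

plug : Tree TFB → Tree TF → Tree TF
plug y z = replace (λ { 𝐓 → leaf 𝐓 ; 𝐅 → leaf 𝐅 ; □ → z }) y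

boxT : Tree TF → Tree TFB
boxT = replace λ { 𝐓 → leaf □ ; 𝐅 → leaf 𝐅 }

boxF : Tree TF → Tree TFB
boxF = replace λ { 𝐓 → leaf 𝐓 ; 𝐅 → leaf □ }

CCD : Tree TF → Tree TFB → Tree TF → Set
CCD x y z = (x ≡ plug y z) × Contains □ y × Contains 𝐅 y × ¬ Contains 𝐓 y
            × Contains 𝐓 z × Contains 𝐅 z

CDD : Tree TF → Tree TFB → Tree TF → Set
CDD x y z = (x ≡ plug y z) × Contains □ y × Contains 𝐓 y × ¬ Contains 𝐅 y
            × Contains 𝐓 z × Contains 𝐅 z

CD : Tree TF → Tree TFB → Tree TF → Set
CD x y z = CCD x y z × (∀ y' z' → CCD x y' z' → ¬ (depth z' < depth z))

DD : Tree TF → Tree TFB → Tree TF → Set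
DD x y z = CDD x y z × (∀ y' z' → CDD x y' z' → ¬ (depth z' < depth z))

module Submission where

-- Both halves of the theorem are one statement for a polarity c ∈ {𝐓, 𝐅}
-- (𝐓 for ∧∘, 𝐅 for ∨∘): writing box c S for S with its c-leaves turned into
-- holes, se (conn c P Q) = (box c (se P))[□ ↦ se Q]  (se-conn).
-- Two invariants of evaluation trees W carry the argument:
--   Rigid c W     — no split of W through a proper c-free frame with a
--                   two-coloured filler (D-terms are 𝐓-rigid, C-terms 𝐅-rigid);
--   Irreducible W — no split of W through a proper frame without colours.
-- The tree lemmas show that a rigid filler is the unique shallowest filler of
-- every c-candidate of the composite (rigid-filler-least), that no frame of the
-- opposite polarity fits it (no-opposite-frame), and that composition preserves
-- both invariants (compose).  Literals have them because their branches are
-- monochrome, so induction on the grammar gives them for all *-terms and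
-- operands, and the theorem follows for both polarities (decomposition).

open import Defs
open import Data.Empty using (⊥; ⊥-elim)
open import Data.Nat using (_≤_; _<_; s≤s)
open import Data.Nat.Properties
  using (≤-refl; ≤-trans; ≤-antisym; <⇒≤; <⇒≱; ≤⇒≯; ≮⇒≥; <-irrefl; <-asym;
         m≤m⊔n; m≤n⊔m; m≤n⇒m≤1+n; m≤n⇒m<n∨m≡n)
open import Data.Product using (_×_; _,_; Σ; proj₁; proj₂)
import Data.Product as Product
open import Data.Sum using (_⊎_; inj₁; inj₂)
import Data.Sum as Sum
open import Function using (_∘_)
open import Relation.Binary.PropositionalEquality
  using (_≡_; refl; sym; trans; cong; subst)
open import Relation.Nullary using (¬_; Dec; yes; no)

colour : TF → TFB
colour 𝐓 = 𝐓
colour 𝐅 = 𝐅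

opp : TF → TF
opp 𝐓 = 𝐅
opp 𝐅 = 𝐓

-- Needed to read a Candidate (opp c) as a frame containing c.
opp-involutive : ∀ c → opp (opp c) ≡ c
opp-involutive 𝐓 = refl
opp-involutive 𝐅 = refl

TwoColoured : Tree TF → Set
TwoColoured X = Contains 𝐓 X × Contains 𝐅 X

pick : ∀ c {X : Tree TF} → TwoColoured X → Contains c X
pick 𝐓 (t , _) = t
pick 𝐅 (_ , f) = f

Pure : Tree TFB → Set
Pure Y = ¬ Contains 𝐓 Y × ¬ Contains 𝐅 Y

pure-avoids : ∀ c {Y : Tree TFB} → Pure Y → ¬ Contains (colour c) Y
pure-avoids 𝐓 (nT , _) = nT
pure-avoids 𝐅 (_ , nF) = nF

pure-from : ∀ c {Y : Tree TFB} → ¬ Contains (colour c) Y → ¬ Contains (colour (opp c)) Y → Pure Y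
pure-from 𝐓 nT nF = nT , nF
pure-from 𝐅 nF nT = nT , nF

node-injective : ∀ {L : Set} {y₁ z₁ y₂ z₂ : Tree L} {a b : Atom} →
  node y₁ a z₁ ≡ node y₂ b z₂ → y₁ ≡ y₂ × a ≡ b × z₁ ≡ z₂
node-injective refl = refl , refl , refl

node-cong : ∀ {L : Set} {y₁ z₁ y₂ z₂ : Tree L} {a b : Atom} →
  y₁ ≡ y₂ → a ≡ b → z₁ ≡ z₂ → node y₁ a z₁ ≡ node y₂ b z₂
node-cong refl refl refl = refl

contains-leaf : ∀ {L : Set} {l m : L} → Contains m (leaf l) → m ≡ l
contains-leaf here = refl

some-leaf : ∀ {L : Set} (t : Tree L) → Σ L (λ l → Contains l t)
some-leaf (leaf l)     = l , here
some-leaf (node y a z) = Product.map₂ left (some-leaf y)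

pure-has-hole : ∀ Y → Pure Y → Contains □ Y
pure-has-hole Y (nT , nF) with some-leaf Y
... | 𝐓 , p = ⊥-elim (nT p)
... | 𝐅 , p = ⊥-elim (nF p)
... | □ , p = p

contains? : (l : TFB) (t : Tree TFB) → Dec (Contains l t)
contains? 𝐓 (leaf 𝐓) = yes here
contains? 𝐅 (leaf 𝐅) = yes here
contains? □ (leaf □) = yes here
contains? 𝐓 (leaf 𝐅) = no λ ()
contains? 𝐓 (leaf □) = no λ ()
contains? 𝐅 (leaf 𝐓) = no λ ()
contains? 𝐅 (leaf □) = no λ ()
contains? □ (leaf 𝐓) = no λ ()
contains? □ (leaf 𝐅) = no λ ()
contains? l (node y a z) with contains? l y | contains? l z
... | yes p | _     = yes (left p)
... | no _  | yes q = yes (right q)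
... | no p  | no q  = no λ { (left r) → p r ; (right r) → q r }

replace-cong : ∀ {L M : Set} {f g : L → Tree M} → (∀ l → f l ≡ g l) →
  ∀ t → replace f t ≡ replace g t
replace-cong f≗g (leaf l)     = f≗g l
replace-cong f≗g (node y a z) = node-cong (replace-cong f≗g y) refl (replace-cong f≗g z)

replace-fuse : ∀ {L M N : Set} (f : M → Tree N) (g : L → Tree M) t →
  replace f (replace g t) ≡ replace (replace f ∘ g) t
replace-fuse f g (leaf l)     = refl
replace-fuse f g (node y a z) = node-cong (replace-fuse f g y) refl (replace-fuse f g z)

replace-contains : ∀ {L M : Set} {f : L → Tree M} {l : L} {m : M} t →
  Contains l t → Contains m (f l) → Contains m (replace f t)
replace-contains (leaf _)     here      p = p
replace-contains (node y a z) (left q)  p = left (replace-contains y q p)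
replace-contains (node y a z) (right q) p = right (replace-contains z q p)

contains-replace : ∀ {L M : Set} {f : L → Tree M} {m : M} t →
  Contains m (replace f t) → Σ L (λ l → Contains l t × Contains m (f l))
contains-replace (leaf l)     p         = l , here , p
contains-replace (node y a z) (left p)  = Product.map₂ (Product.map₁ left) (contains-replace y p)
contains-replace (node y a z) (right p) = Product.map₂ (Product.map₁ right) (contains-replace z p)

contains-plug : ∀ {l : TF} Y Z → Contains l (plug Y Z) →
  Contains (colour l) Y ⊎ (Contains □ Y × Contains l Z)
contains-plug (leaf 𝐓)     Z here      = inj₁ here
contains-plug (leaf 𝐅)     Z here      = inj₁ here
contains-plug (leaf □)     Z p         = inj₂ (here , p)
contains-plug (node y a z) Z (left p)  = Sum.map left (Product.map₁ left) (contains-plug y Z p)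
contains-plug (node y a z) Z (right p) = Sum.map right (Product.map₁ right) (contains-plug z Z p)

plug-contains : ∀ {l : TF} Y Z → Contains □ Y → Contains l Z → Contains l (plug Y Z)
plug-contains (leaf □)     Z here      q = q
plug-contains (node y a z) Z (left p)  q = left (plug-contains y Z p q)
plug-contains (node y a z) Z (right p) q = right (plug-contains z Z p q)

pure-plug-filler : ∀ {l : TF} {X} Y Z → X ≡ plug Y Z → Pure Y → Contains l X → Contains l Z
pure-plug-filler {l} Y Z refl pure x with contains-plug Y Z x
... | inj₁ c       = ⊥-elim (pure-avoids l pure c)
... | inj₂ (_ , z) = z

depth-plug : ∀ Y W → Contains □ Y → depth W ≤ depth (plug Y W)
depth-plug (leaf □)     W here      = ≤-refl
depth-plug (node y a z) W (left p)  = m≤n⇒m≤1+n (≤-trans (depth-plug y W p) (m≤m⊔n _ _))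
depth-plug (node y a z) W (right p) = m≤n⇒m≤1+n (≤-trans (depth-plug z W p) (m≤n⊔m _ _))

depth-plug-node : ∀ y a z W → Contains □ (node y a z) → depth W < depth (plug (node y a z) W)
depth-plug-node y a z W (left p)  = s≤s (≤-trans (depth-plug y W p) (m≤m⊔n _ _))
depth-plug-node y a z W (right p) = s≤s (≤-trans (depth-plug z W p) (m≤n⊔m _ _))

filler-shallower : ∀ (l : TF) y a z Z W → W ≡ plug (node y a z) Z →
  ¬ Contains (colour l) (node y a z) → Contains l W → depth Z < depth W
filler-shallower l y a z Z W refl n w with contains-plug (node y a z) Z w
... | inj₁ q       = ⊥-elim (n q)
... | inj₂ (q , _) = depth-plug-node y a z Z q

trivial-frame : ∀ c Y W → W ≡ plug Y W → ¬ Contains (colour c) Y → Contains c W → Y ≡ leaf □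
trivial-frame c (leaf □) W e n w = refl
trivial-frame 𝐓 (leaf 𝐓) W e n w = ⊥-elim (n here)
trivial-frame 𝐅 (leaf 𝐅) W e n w = ⊥-elim (n here)
trivial-frame 𝐓 (leaf 𝐅) W e n w with contains-leaf (subst (Contains 𝐓) e w)
... | ()
trivial-frame 𝐅 (leaf 𝐓) W e n w with contains-leaf (subst (Contains 𝐅) e w)
... | ()
trivial-frame c (node y a z) W e n w = ⊥-elim (<-irrefl refl (filler-shallower c y a z W W e n w))

plug-cancel : ∀ c Y₁ Y₂ W → plug Y₁ W ≡ plug Y₂ W →
  ¬ Contains (colour c) Y₁ → ¬ Contains (colour c) Y₂ → Contains c W → Y₁ ≡ Y₂
plug-cancel c (leaf □)        Y₂       W e n₁ n₂ w = sym (trivial-frame c Y₂ W e n₂ w)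
plug-cancel c Y₁@(leaf 𝐓)     (leaf □) W e n₁ n₂ w = trivial-frame c Y₁ W (sym e) n₁ w
plug-cancel c Y₁@(leaf 𝐅)     (leaf □) W e n₁ n₂ w = trivial-frame c Y₁ W (sym e) n₁ w
plug-cancel c Y₁@(node _ _ _) (leaf □) W e n₁ n₂ w = trivial-frame c Y₁ W (sym e) n₁ w
plug-cancel c (leaf 𝐓) (leaf 𝐓) W e n₁ n₂ w = refl
plug-cancel c (leaf 𝐅) (leaf 𝐅) W e n₁ n₂ w = refl
plug-cancel c (leaf 𝐓) (leaf 𝐅) W () n₁ n₂ w
plug-cancel c (leaf 𝐅) (leaf 𝐓) W () n₁ n₂ w
plug-cancel c (leaf 𝐓) (node _ _ _) W () n₁ n₂ w
plug-cancel c (leaf 𝐅) (node _ _ _) W () n₁ n₂ w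
plug-cancel c (node _ _ _) (leaf 𝐓) W () n₁ n₂ w
plug-cancel c (node _ _ _) (leaf 𝐅) W () n₁ n₂ w
plug-cancel c (node y₁ a z₁) (node y₂ b z₂) W e n₁ n₂ w with node-injective e
... | ey , ea , ez =
  node-cong (plug-cancel c y₁ y₂ W ey (n₁ ∘ left) (n₂ ∘ left) w) ea
            (plug-cancel c z₁ z₂ W ez (n₁ ∘ right) (n₂ ∘ right) w)

mark : TF → TF → TFB
mark 𝐓 𝐓 = □
mark 𝐓 𝐅 = 𝐅
mark 𝐅 𝐓 = 𝐓
mark 𝐅 𝐅 = □

mark-injective : ∀ c {l l'} → mark c l ≡ mark c l' → l ≡ l'
mark-injective 𝐓 {𝐓} {𝐓} _ = refl
mark-injective 𝐓 {𝐅} {𝐅} _ = refl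
mark-injective 𝐅 {𝐓} {𝐓} _ = refl
mark-injective 𝐅 {𝐅} {𝐅} _ = refl
mark-injective 𝐓 {𝐓} {𝐅} ()
mark-injective 𝐓 {𝐅} {𝐓} ()
mark-injective 𝐅 {𝐓} {𝐅} ()
mark-injective 𝐅 {𝐅} {𝐓} ()

box : TF → Tree TF → Tree TFB
box c = replace (leaf ∘ mark c)

boxT≡box𝐓 : ∀ S → boxT S ≡ box 𝐓 S
boxT≡box𝐓 = replace-cong λ { 𝐓 → refl ; 𝐅 → refl }

boxF≡box𝐅 : ∀ S → boxF S ≡ box 𝐅 S
boxF≡box𝐅 = replace-cong λ { 𝐓 → refl ; 𝐅 → refl }

box-avoids : ∀ c S → ¬ Contains (colour c) (box c S)
box-avoids 𝐓 (leaf 𝐓) ()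
box-avoids 𝐓 (leaf 𝐅) ()
box-avoids 𝐅 (leaf 𝐓) ()
box-avoids 𝐅 (leaf 𝐅) ()
box-avoids c (node y a z) (left p)  = box-avoids c y p
box-avoids c (node y a z) (right p) = box-avoids c z p

box-hole : ∀ c S → Contains c S → Contains □ (box c S)
box-hole 𝐓 (leaf 𝐓) here = here
box-hole 𝐅 (leaf 𝐅) here = here
box-hole c (node y a z) (left p)  = left (box-hole c y p)
box-hole c (node y a z) (right p) = right (box-hole c z p)

box-keeps-opp : ∀ c S → Contains (opp c) S → Contains (colour (opp c)) (box c S)
box-keeps-opp 𝐓 (leaf 𝐅) here = here
box-keeps-opp 𝐅 (leaf 𝐓) here = here
box-keeps-opp c (node y a z) (left p)  = left (box-keeps-opp c y p)
box-keeps-opp c (node y a z) (right p) = right (box-keeps-opp c z p)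

-- Boxing forgets nothing: the hole marks exactly the c-leaves.
box-injective : ∀ c S S' → box c S ≡ box c S' → S ≡ S'
box-injective c (leaf l) (leaf l') e = cong leaf (mark-injective c (cong label e))
  where
    label : Tree TFB → TFB
    label (leaf m)     = m
    label (node _ _ _) = □
box-injective c (node y a z) (node y' b z') e with node-injective e
... | ey , ea , ez = node-cong (box-injective c y y' ey) ea (box-injective c z z' ez)

composite-not-leaf : ∀ c S W → plug (box c S) W ≡ leaf c → ¬ Contains (opp c) W
composite-not-leaf 𝐓 (leaf 𝐓) W e o with contains-leaf (subst (Contains 𝐅) e o)
... | ()
composite-not-leaf 𝐅 (leaf 𝐅) W e o with contains-leaf (subst (Contains 𝐓) e o)
... | ()

conn : TF → SCL → SCL → SCL
conn 𝐓 = _∧∘_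
conn 𝐅 = _∨∘_

se-conn : ∀ c P Q → se (conn c P Q) ≡ plug (box c (se P)) (se Q)
se-conn 𝐓 P Q = sym (trans (replace-fuse _ _ (se P)) (replace-cong (λ { 𝐓 → refl ; 𝐅 → refl }) (se P)))
se-conn 𝐅 P Q = sym (trans (replace-fuse _ _ (se P)) (replace-cong (λ { 𝐓 → refl ; 𝐅 → refl }) (se P)))

-- Candidate 𝐓 is CCD and Candidate 𝐅 is CDD (definitionally); likewise for
-- Decomposition and CD, DD.
Candidate : TF → Tree TF → Tree TFB → Tree TF → Set
Candidate c x y z = (x ≡ plug y z) × Contains □ y × Contains (colour (opp c)) y
                    × ¬ Contains (colour c) y × TwoColoured z

Decomposition : TF → Tree TF → Tree TFB → Tree TF → Set
Decomposition c x y z = Candidate c x y z × (∀ y' z' → Candidate c x y' z' → ¬ (depth z' < depth z))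

Rigid : TF → Tree TF → Set
Rigid c X = ∀ Y₁ a Y₂ Z → X ≡ plug (node Y₁ a Y₂) Z →
  ¬ Contains (colour c) (node Y₁ a Y₂) → ¬ TwoColoured Z

Irreducible : Tree TF → Set
Irreducible X = ∀ Y₁ a Y₂ Z → X ≡ plug (node Y₁ a Y₂) Z → ¬ Pure (node Y₁ a Y₂)

-- For two-coloured trees, rigidity of either polarity implies irreducibility,
-- since the filler of a pure frame inherits both colours.
rigid⇒irreducible : ∀ c {X} → TwoColoured X → Rigid c X → Irreducible X
rigid⇒irreducible c (t , f) rigid Y₁ a Y₂ Z e pure =
  rigid Y₁ a Y₂ Z e (pure-avoids c pure)
    (pure-plug-filler (node Y₁ a Y₂) Z e pure t , pure-plug-filler (node Y₁ a Y₂) Z e pure f)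

rigid-filler-least : ∀ c Y W Y' Z' → plug Y W ≡ plug Y' Z' →
  ¬ Contains (colour c) Y → Contains □ Y → Contains c W → Rigid c W →
  ¬ Contains (colour c) Y' → TwoColoured Z' →
  depth W ≤ depth Z' × (depth W ≡ depth Z' → Y ≡ Y' × W ≡ Z')
rigid-filler-least c (leaf □) W (leaf □) Z' refl n h w rigid n' tc = ≤-refl , λ _ → refl , refl
rigid-filler-least c (leaf □) W (leaf 𝐓) Z' e n h w rigid n' tc
  with contains-leaf (subst (Contains c) e w)
... | refl = ⊥-elim (n' here)
rigid-filler-least c (leaf □) W (leaf 𝐅) Z' e n h w rigid n' tc
  with contains-leaf (subst (Contains c) e w)
... | refl = ⊥-elim (n' here)
rigid-filler-least c (leaf □) W (node y a z) Z' e n h w rigid n' tc = ⊥-elim (rigid y a z Z' e n' tc)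
rigid-filler-least c (node y a z) W (leaf □) Z' refl n h w rigid n' tc =
  <⇒≤ deeper , λ eq → ⊥-elim (<-irrefl eq deeper)
  where
    deeper : depth W < depth (plug (node y a z) W)
    deeper = depth-plug-node y a z W h
rigid-filler-least c (node y a z) W (node y' b z') Z' e n (left h) w rigid n' tc
  with node-injective e
... | ey , ea , ez with rigid-filler-least c y W y' Z' ey (n ∘ left) h w rigid (n' ∘ left) tc
... | le , same = le , λ eq →
  let (y≡y' , W≡Z') = same eq
  in node-cong y≡y' ea (plug-cancel c z z' W (trans ez (cong (plug z') (sym W≡Z'))) (n ∘ right) (n' ∘ right) w)
     , W≡Z'
rigid-filler-least c (node y a z) W (node y' b z') Z' e n (right h) w rigid n' tc
  with node-injective e
... | ey , ea , ez with rigid-filler-least c z W z' Z' ez (n ∘ right) h w rigid (n' ∘ right) tc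
... | le , same = le , λ eq →
  let (z≡z' , W≡Z') = same eq
  in node-cong (plug-cancel c y y' W (trans ey (cong (plug y') (sym W≡Z'))) (n ∘ left) (n' ∘ left) w) ea z≡z'
     , W≡Z'

opposite-filler-shallower : ∀ c S W Y Z → plug (box c S) W ≡ plug Y Z →
  ¬ Contains (colour (opp c)) Y → Contains (colour c) Y → Contains (opp c) W → depth Z < depth W
opposite-filler-shallower 𝐓 S W (leaf 𝐓) Z e n here o = ⊥-elim (composite-not-leaf 𝐓 S W e o)
opposite-filler-shallower 𝐅 S W (leaf 𝐅) Z e n here o = ⊥-elim (composite-not-leaf 𝐅 S W e o)
opposite-filler-shallower c (node s₁ b s₂) W (node y a z) Z e n (left h) o =
  opposite-filler-shallower c s₁ W y Z (proj₁ (node-injective e)) (n ∘ left) h o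
opposite-filler-shallower c (node s₁ b s₂) W (node y a z) Z e n (right h) o =
  opposite-filler-shallower c s₂ W z Z (proj₂ (proj₂ (node-injective e))) (n ∘ right) h o
opposite-filler-shallower 𝐓 (leaf 𝐓) W (node y a z) Z e n h o = filler-shallower 𝐅 y a z Z W e n o
opposite-filler-shallower 𝐅 (leaf 𝐅) W (node y a z) Z e n h o = filler-shallower 𝐓 y a z Z W e n o

opposite-filler-deep : ∀ c S W Y Z → plug (box c S) W ≡ plug Y Z →
  Contains (opp c) S → ¬ Contains (colour (opp c)) Y → Contains c Z → depth W ≤ depth Z
opposite-filler-deep c S W (leaf □) Z e s n z with contains-plug (box c S) W (subst (Contains c) (sym e) z)
... | inj₁ q       = ⊥-elim (box-avoids c S q)
... | inj₂ (q , _) = subst (λ u → depth W ≤ depth u) e (depth-plug (box c S) W q)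
opposite-filler-deep 𝐓 (leaf 𝐅) W (leaf 𝐅) Z e here n z = ⊥-elim (n here)
opposite-filler-deep 𝐅 (leaf 𝐓) W (leaf 𝐓) Z e here n z = ⊥-elim (n here)
opposite-filler-deep 𝐓 (leaf 𝐅) W (leaf 𝐓) Z () here n z
opposite-filler-deep 𝐅 (leaf 𝐓) W (leaf 𝐅) Z () here n z
opposite-filler-deep 𝐓 (leaf 𝐅) W (node _ _ _) Z () here n z
opposite-filler-deep 𝐅 (leaf 𝐓) W (node _ _ _) Z () here n z
opposite-filler-deep c (node s₁ b s₂) W (node y a x) Z e (left s) n z =
  opposite-filler-deep c s₁ W y Z (proj₁ (node-injective e)) s (n ∘ left) z
opposite-filler-deep c (node s₁ b s₂) W (node y a x) Z e (right s) n z =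
  opposite-filler-deep c s₂ W x Z (proj₂ (proj₂ (node-injective e))) s (n ∘ right) z

no-opposite-frame : ∀ c S W Y Z → plug (box c S) W ≡ plug Y Z →
  Contains (opp c) S → Contains (opp c) W →
  ¬ Contains (colour (opp c)) Y → Contains (colour c) Y → ¬ Contains c Z
no-opposite-frame c S W Y Z e s w n y z =
  <⇒≱ (opposite-filler-shallower c S W Y Z e n y w) (opposite-filler-deep c S W Y Z e s n z)

-- The invariant of *-terms.
Good : Tree TF → Set
Good X = TwoColoured X × Irreducible X

factor-through-pure : ∀ c S V Y Z → plug (box c S) V ≡ plug Y Z → Pure Y →
  depth V < depth Z → Contains c V → Σ (Tree TF) (λ S' → Z ≡ plug (box c S') V × S ≡ plug Y S')
factor-through-pure c S V (leaf □) Z e pure lt v = S , sym e , refl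
factor-through-pure c S V (leaf 𝐓) Z e pure lt v = ⊥-elim (proj₁ pure here)
factor-through-pure c S V (leaf 𝐅) Z e pure lt v = ⊥-elim (proj₂ pure here)
factor-through-pure 𝐓 (leaf 𝐓) V (node y a z) Z refl pure lt v =
  ⊥-elim (<-asym lt (depth-plug-node y a z Z (pure-has-hole _ pure)))
factor-through-pure 𝐅 (leaf 𝐅) V (node y a z) Z refl pure lt v =
  ⊥-elim (<-asym lt (depth-plug-node y a z Z (pure-has-hole _ pure)))
factor-through-pure c (node s₁ b s₂) V (node y a z) Z e (nT , nF) lt v with node-injective e
... | e₁ , ea , e₂ with factor-through-pure c s₁ V y Z e₁ (nT ∘ left , nF ∘ left) lt v
                     | factor-through-pure c s₂ V z Z e₂ (nT ∘ right , nF ∘ right) lt v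
... | S₁ , Z≡S₁ , s₁≡ | S₂ , Z≡S₂ , s₂≡ = S₁ , Z≡S₁ , node-cong s₁≡ ea (trans s₂≡ (cong (plug z) (sym S₁≡S₂)))
  where
    S₁≡S₂ : S₁ ≡ S₂
    S₁≡S₂ = box-injective c S₁ S₂
      (plug-cancel c (box c S₁) (box c S₂) V (trans (sym Z≡S₁) Z≡S₂) (box-avoids c S₁) (box-avoids c S₂) v)

-- Composing a good S with a two-coloured c-rigid W yields an irreducible tree:
-- a pure split is a c-candidate, so its filler is at least as deep as W; equal
-- depth would make the frame box c S, which has opp c-leaves, and a deeper
-- filler would split the irreducible S.
composite-irreducible : ∀ c S W → Good S → TwoColoured W → Rigid c W →
  Irreducible (plug (box c S) W)
composite-irreducible c S W (tS , irrS) tW rigid Y₁ a Y₂ Z e pure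
  with rigid-filler-least c (box c S) W (node Y₁ a Y₂) Z e (box-avoids c S) hole (pick c tW) rigid
         (pure-avoids c pure) (filler 𝐓 , filler 𝐅)
  where
    hole : Contains □ (box c S)
    hole = box-hole c S (pick c tS)
    filler : ∀ l → Contains l Z
    filler l = pure-plug-filler (node Y₁ a Y₂) Z e pure (plug-contains (box c S) W hole (pick l tW))
... | le , same with m≤n⇒m<n∨m≡n le
... | inj₂ eq = pure-avoids (opp c) pure
                  (subst (Contains (colour (opp c))) (proj₁ (same eq)) (box-keeps-opp c S (pick (opp c) tS)))
... | inj₁ lt with factor-through-pure c S W (node Y₁ a Y₂) Z e pure lt (pick c tW)
... | S' , _ , S≡ = irrS Y₁ a Y₂ S' S≡ pure

-- ... which is moreover rigid for the opposite polarity: an (opp c)-free frame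
-- either contains c, excluded by no-opposite-frame, or is pure.
composite-rigid : ∀ c S W → Good S → TwoColoured W → Rigid c W →
  Rigid (opp c) (plug (box c S) W)
composite-rigid c S W gS tW rigid Y₁ a Y₂ Z e n tZ with contains? (colour c) (node Y₁ a Y₂)
... | yes p = no-opposite-frame c S W (node Y₁ a Y₂) Z e (pick (opp c) (proj₁ gS)) (pick (opp c) tW) n p (pick c tZ)
... | no np = composite-irreducible c S W gS tW rigid Y₁ a Y₂ Z e (pure-from c np n)

compose : ∀ c S W → Good S → Good W → Rigid c W →
  Good (plug (box c S) W) × Rigid (opp c) (plug (box c S) W)
compose c S W gS (tW , _) rigid =
  ( (plug-contains (box c S) W hole (pick 𝐓 tW) , plug-contains (box c S) W hole (pick 𝐅 tW))
  , composite-irreducible c S W gS tW rigid )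
  , composite-rigid c S W gS tW rigid
  where
    hole : Contains □ (box c S)
    hole = box-hole c S (pick c (proj₁ gS))

Monochrome : TF → Tree TF → Set
Monochrome c M = Contains c M × ¬ Contains (opp c) M

monochrome-replace : ∀ c {f : TF → Tree TF} t → Monochrome c t → Monochrome c (f c) →
  Monochrome c (replace f t)
monochrome-replace c {f} t (ct , nt) (cf , nf) =
  replace-contains t ct cf , λ q → source c (contains-replace t q) refl
  where
    source : ∀ d → Σ TF (λ l → Contains l t × Contains (opp c) (f l)) → d ≡ c → ⊥
    source 𝐓 (𝐓 , _ , r) refl = nf r
    source 𝐓 (𝐅 , q , _) refl = nt q
    source 𝐅 (𝐓 , q , _) refl = nt q
    source 𝐅 (𝐅 , _ , r) refl = nf r

monochrome-node : ∀ c {L R : Tree TF} {a : Atom} → Monochrome c L → Monochrome c R →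
  Monochrome c (node L a R)
monochrome-node c (cL , nL) (_ , nR) = left cL , λ { (left q) → nL q ; (right q) → nR q }

T-term-monochrome : ∀ {P} → IsT P → Monochrome 𝐓 (se P)
T-term-monochrome tT = here , λ ()
T-term-monochrome (tCons p q) =
  monochrome-node 𝐓 (monochrome-replace 𝐓 _ (T-term-monochrome p) (here , λ ())) (T-term-monochrome q)

F-term-monochrome : ∀ {P} → IsF P → Monochrome 𝐅 (se P)
F-term-monochrome fF = here , λ ()
F-term-monochrome (fCons p q) =
  monochrome-node 𝐅 (F-term-monochrome q) (monochrome-replace 𝐅 _ (F-term-monochrome p) (here , λ ()))

-- A c-free frame cannot split a monochrome c tree with a two-coloured filler:
-- the c-leaves come from the filler, which then exposes an opp c-leaf.
monochrome-no-split : ∀ {c M} Y Z → Monochrome c M → M ≡ plug Y Z →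
  ¬ Contains (colour c) Y → ¬ TwoColoured Z
monochrome-no-split {c} Y Z (cM , nM) refl n tZ with contains-plug Y Z cM
... | inj₁ q       = n q
... | inj₂ (h , _) = nM (plug-contains Y Z h (pick (opp c) tZ))

-- The evaluation of a literal is a node whose branches are monochrome of opposite colours.
Branches : Tree TF → Tree TF → Set
Branches L R = (Monochrome 𝐓 L × Monochrome 𝐅 R) ⊎ (Monochrome 𝐅 L × Monochrome 𝐓 R)

branches-rigid : ∀ c {L a R} → Branches L R → Rigid c (node L a R)
branches-rigid 𝐓 (inj₁ (mL , _)) Y₁ b Y₂ Z e n = monochrome-no-split Y₁ Z mL (proj₁ (node-injective e)) (n ∘ left)
branches-rigid 𝐅 (inj₁ (_ , mR)) Y₁ b Y₂ Z e n = monochrome-no-split Y₂ Z mR (proj₂ (proj₂ (node-injective e))) (n ∘ right)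
branches-rigid 𝐓 (inj₂ (_ , mR)) Y₁ b Y₂ Z e n = monochrome-no-split Y₂ Z mR (proj₂ (proj₂ (node-injective e))) (n ∘ right)
branches-rigid 𝐅 (inj₂ (mL , _)) Y₁ b Y₂ Z e n = monochrome-no-split Y₁ Z mL (proj₁ (node-injective e)) (n ∘ left)

branches-two-coloured : ∀ {L a R} → Branches L R → TwoColoured (node L a R)
branches-two-coloured (inj₁ ((tL , _) , (fR , _))) = left tL , right fR
branches-two-coloured (inj₂ ((fL , _) , (tR , _))) = right tR , left fL

branch-invariants : ∀ {L a R} → Branches L R → Good (node L a R) × (∀ c → Rigid c (node L a R))
branch-invariants br =
  (branches-two-coloured br , rigid⇒irreducible 𝐓 (branches-two-coloured br) (branches-rigid 𝐓 br))
  , λ c → branches-rigid c br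

literal-invariants : ∀ {P} → IsLit P → Good (se P) × (∀ c → Rigid c (se P))
literal-invariants (lPos p q) =
  branch-invariants (inj₁ (monochrome-replace 𝐓 _ (T-term-monochrome p) (here , λ ()) , F-term-monochrome q))
literal-invariants (lNeg p q) =
  branch-invariants (inj₂ (F-term-monochrome q , monochrome-replace 𝐓 _ (T-term-monochrome p) (here , λ ())))

Operand : TF → SCL → Set
Operand 𝐓 = IsD
Operand 𝐅 = IsC

conn-invariants : ∀ c P Q → Good (se P) → Good (se Q) × Rigid c (se Q) →
  Good (se (conn c P Q)) × Rigid (opp c) (se (conn c P Q))
conn-invariants c P Q gP (gQ , rQ) =
  subst (λ X → Good X × Rigid (opp c) X) (sym (se-conn c P Q)) (compose c (se P) (se Q) gP gQ rQ)

mutual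
  star-good : ∀ {P} → IsStar P → Good (se P)
  star-good (sC p) = proj₁ (operand-invariants 𝐅 p)
  star-good (sD p) = proj₁ (operand-invariants 𝐓 p)

  operand-invariants : ∀ c {Q} → Operand c Q → Good (se Q) × Rigid c (se Q)
  operand-invariants 𝐓 (dLit l) = Product.map₂ (λ rigid → rigid 𝐓) (literal-invariants l)
  operand-invariants 𝐅 (cLit l) = Product.map₂ (λ rigid → rigid 𝐅) (literal-invariants l)
  operand-invariants 𝐓 (dOr {P} {Q} s q)  = conn-invariants 𝐅 P Q (star-good s) (operand-invariants 𝐅 q)
  operand-invariants 𝐅 (cAnd {P} {Q} s q) = conn-invariants 𝐓 P Q (star-good s) (operand-invariants 𝐓 q)

UniqueDecomposition : TF → Tree TF → Tree TFB → Tree TF → Set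
UniqueDecomposition c x y z = Decomposition c x y z × (∀ y' z' → Decomposition c x y' z' → y' ≡ y × z' ≡ z)

rebox : ∀ c {x y y' z} → y' ≡ y → UniqueDecomposition c x y z → UniqueDecomposition c x y' z
rebox c refl u = u

decomposition : ∀ c P Q → IsStar P → Operand c Q →
  UniqueDecomposition c (se (conn c P Q)) (box c (se P)) (se Q)
  × (∀ Y Z → ¬ Decomposition (opp c) (se (conn c P Q)) Y Z)
decomposition c P Q sP oQ = ((candidate , minimal) , unique) , no-opposite
  where
    S = se P
    W = se Q
    X = se (conn c P Q)
    tS : TwoColoured S
    tS = proj₁ (star-good sP)
    tW : TwoColoured W
    tW = proj₁ (proj₁ (operand-invariants c oQ))
    candidate : Candidate c X (box c S) W
    candidate = se-conn c P Q , box-hole c S (pick c tS) , box-keeps-opp c S (pick (opp c) tS) , box-avoids c S , tW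
    least : ∀ Y Z → Candidate c X Y Z → depth W ≤ depth Z × (depth W ≡ depth Z → box c S ≡ Y × W ≡ Z)
    least Y Z (e , _ , _ , n , tZ) =
      rigid-filler-least c (box c S) W Y Z (trans (sym (se-conn c P Q)) e) (box-avoids c S)
        (box-hole c S (pick c tS)) (pick c tW) (proj₂ (operand-invariants c oQ)) n tZ
    minimal : ∀ Y Z → Candidate c X Y Z → ¬ (depth Z < depth W)
    minimal Y Z cand = ≤⇒≯ (proj₁ (least Y Z cand))
    unique : ∀ Y Z → Decomposition c X Y Z → Y ≡ box c S × Z ≡ W
    unique Y Z (cand , min) =
      let (S≡Y , W≡Z) = proj₂ (least Y Z cand) (≤-antisym (proj₁ (least Y Z cand)) (≮⇒≥ (min _ _ candidate)))
      in sym S≡Y , sym W≡Z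
    no-opposite : ∀ Y Z → ¬ Decomposition (opp c) X Y Z
    no-opposite Y Z ((e , _ , y , n , tZ) , _) =
      no-opposite-frame c S W Y Z (trans (sym (se-conn c P Q)) e) (pick (opp c) tS) (pick (opp c) tW) n
        (subst (λ d → Contains (colour d) Y) (opp-involutive c) y) (pick c tZ)

mainTheorem11 : (∀ P Q → IsStar P → IsD Q →
    CD (se (P ∧∘ Q)) (boxT (se P)) (se Q)
    × (∀ Y Z → CD (se (P ∧∘ Q)) Y Z → (Y ≡ boxT (se P)) × (Z ≡ se Q))
    × (∀ Y Z → ¬ DD (se (P ∧∘ Q)) Y Z))
    × (∀ P Q → IsStar P → IsC Q →
    (∀ Y Z → ¬ CD (se (P ∨∘ Q)) Y Z)
    × DD (se (P ∨∘ Q)) (boxF (se P)) (se Q)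
    × (∀ Y Z → DD (se (P ∨∘ Q)) Y Z → (Y ≡ boxF (se P)) × (Z ≡ se Q)))
mainTheorem11 =
  (λ P Q sP dQ →
    let (uniqueCD , noDD) = decomposition 𝐓 P Q sP dQ
        (cd , uniq)        = rebox 𝐓 (boxT≡box𝐓 (se P)) uniqueCD
    in cd , uniq , noDD)
  , (λ P Q sP cQ →
    let (uniqueDD , noCD) = decomposition 𝐅 P Q sP cQ
        (dd , uniq)        = rebox 𝐅 (boxF≡box𝐅 (se P)) uniqueDD
    in noCD , dd , uniq)
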